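{- Let $\varepsilon\colon X^{\times}_{\mathrm{irr}}\to\mathcal{P}(M)$ be a Fitch map and let $$\mathcal{R}(\varepsilon)=\bigcup_{N\in\mathcal{N}[\varepsilon]}\{ab|c : a,b\in N,\ c\in X\setminus N\}.$$ Then (1) every edge-labeled tree $(T,\lambda)$ that explains $\varepsilon$ displays all triples in $\mathcal{R}(\varepsilon)$, i.e. $\mathcal{R}(\varepsilon)\subseteq\mathfrak{R}(T)$; and (2) $\mathcal{R}(\varepsilon)$ is closed, i.e. $\overline{\mathcal{R}(\varepsilon)}=\mathcal{R}(\varepsilon)$.
   Context: $X$ is a finite nonempty set, $M$ a finite nonempty set of colors, $X^{\times}_{\mathrm{irr}}=\{(x,y)\in X\times X: x\neq y\}$. A phylogenetic tree on $X$ is a rooted tree whose leaves (non-root vertices of degree $1$) form $X$, whose root has degree $\ge2$ and whose non-root inner vertices have degree $\ge3$. $v\preceq w$ means $v$ lies on the path from the root to $w$ ($\prec$ its strict version); $\mathrm{lca}$ of a vertex set is its $\preceq$-maximal common ancestor. A rooted triple $ab|c$ (on three distinct leaves $a,b,c$) is displayed by a tree $T$ if $\mathrm{lca}_T(a,b,c)\prec\mathrm{lca}_T(a,b)$; $\mathfrak{R}(T)$ is the set of triples displayed by $T$. A set $R$ of triples is compatible if some tree displays all of them, and for compatible $R$ its closure $\overline{R}$ is the intersection of $\mathfrak{R}(T)$ over all phylogenetic trees $T$ (on $X$) displaying $R$. An edge-labeled tree $(T,\lambda)$ on $X$ with $M$ is a phylogenetic tree $T$ on $X$ with $\lambda\colon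 E(T)\to\mathcal{P}(M)$; $e$ is an $m$-edge if $m\in\lambda(e)$. $(T,\lambda)$ explains $\varepsilon$ if for all $(x,y)\in X^{\times}_{\mathrm{irr}}$, $m\in M$: $m\in\varepsilon(x,y)$ iff the path from $\mathrm{lca}(x,y)$ to $y$ contains an $m$-edge; $\varepsilon$ is a Fitch map if some edge-labeled tree explains it. $N_m[y]=\{x\in X\setminus\{y\}: m\notin\varepsilon(x,y)\}\cup\{y\}$ and $\mathcal{N}[\varepsilon]=\{N_m[y]: y\in X, m\in M\}$. -}

module Defs where

open import Data.Nat using (ℕ; zero; suc; _≤_)
open import Data.Fin using (Fin)
open import Data.Fin.Subset using (Subset; _∈_; _∉_)
open import Data.List using (List; []; _∷_; _++_; length)
open import Data.List.Relation.Unary.All using (All)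
open import Data.Maybe using (Maybe; just; nothing)
open import Data.Product using (Σ; _×_; _,_; ∃)
open import Data.Sum using (_⊎_)
open import Data.Unit using (⊤)
open import Relation.Binary.PropositionalEquality using (_≡_; _≢_)

-- A vertex is 'node cs' (inner vertex, children cs, each child paired
-- with the label of the edge from this vertex to that child) or
-- 'leaf x'.  The root is the whole tree; every non-root vertex v is
-- identified with the edge (parent(v), v).

data Tree (L X : Set) : Set where
  leaf : X → Tree L X
  node : List (L × Tree L X) → Tree L X

nth : {A : Set} → List A → ℕ → Maybe A
nth []       _       = nothing
nth (a ∷ as) zero    = just a
nth (a ∷ as) (suc i) = nth as i

-- Vertices are addressed by paths from the root (lists of child indices).
Path : Set
Path = List ℕ

data Sub {L X : Set} : Tree L X → Path → Tree L X → Set where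
  here  : ∀ {t} → Sub t [] t
  there : ∀ {cs i l c p s} → nth cs i ≡ just (l , c) → Sub c p s →
          Sub (node cs) (i ∷ p) s

data Lab {L X : Set} : Tree L X → Path → L → Set where
  lab-top  : ∀ {cs i l c} → nth cs i ≡ just (l , c) →
             Lab (node cs) (i ∷ []) l
  lab-deep : ∀ {cs i l' c j p l} → nth cs i ≡ just (l' , c) →
             Lab c (j ∷ p) l → Lab (node cs) (i ∷ j ∷ p) l

Vertex : {L X : Set} → Tree L X → Path → Set
Vertex {L} {X} t p = Σ (Tree L X) (λ s → Sub t p s)

LeafPos : {L X : Set} → Tree L X → X → Path → Set
LeafPos t x p = Sub t p (leaf x)

_⪯_ : Path → Path → Set
p ⪯ q = Σ Path (λ r → p ++ r ≡ q)

_≺_ : Path → Path → Set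
p ≺ q = Σ ℕ (λ i → Σ Path (λ r → p ++ (i ∷ r) ≡ q))

IsLCA : {L X : Set} → Tree L X → List Path → Path → Set
IsLCA t ps u =
  Vertex t u × All (u ⪯_) ps ×
  (∀ v → Vertex t v → All (v ⪯_) ps → v ⪯ u)

data IsNode {L X : Set} : Tree L X → Set where
  isNode : ∀ {cs} → IsNode (node cs)

-- Phylogenetic tree on X: root has degree ≥ 2, non-root inner vertices
-- have degree ≥ 3 (i.e. every inner vertex has ≥ 2 children), and the
-- leaves are in bijection with X (each x labels exactly one leaf).
Phylo : {L X : Set} → Tree L X → Set
Phylo {L} {X} t =
  IsNode t ×
  (∀ p (cs : List (L × Tree L X)) → Sub t p (node cs) → 2 ≤ length cs) ×
  (∀ (x : X) → Σ Path (λ p → LeafPos t x p × (∀ q → LeafPos t x q → q ≡ p)))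

-- Rooted triples ab|c are encoded as (a , b , c).

Displays : {L X : Set} → Tree L X → X → X → X → Set
Displays t a b c =
  a ≢ b × a ≢ c × b ≢ c ×
  Σ Path λ pa → Σ Path λ pb → Σ Path λ pc → Σ Path λ u → Σ Path λ w →
    LeafPos t a pa × LeafPos t b pb × LeafPos t c pc ×
    IsLCA t (pa ∷ pb ∷ pc ∷ []) u × IsLCA t (pa ∷ pb ∷ []) w × u ≺ w

TripleSet : Set → Set₁
TripleSet X = X → X → X → Set

PTree : Set → Set
PTree X = Tree ⊤ X

DisplaysAll : {L X : Set} → Tree L X → TripleSet X → Set
DisplaysAll t R = ∀ a b c → R a b c → Displays t a b c

Compatible : {X : Set} → TripleSet X → Set
Compatible {X} R = Σ (PTree X) (λ T → Phylo T × DisplaysAll T R)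

Closure : {X : Set} → TripleSet X → TripleSet X
Closure {X} R a b c = ∀ (T : PTree X) → Phylo T → DisplaysAll T R → Displays T a b c

Closed : {X : Set} → TripleSet X → Set
Closed R = Compatible R × (∀ a b c → (Closure R a b c → R a b c) × (R a b c → Closure R a b c))

-- Edge-labelled trees, Fitch maps.  X = Fin (suc n), M = Fin (suc k).
-- ε is given as a total map X → X → 𝒫(M); only values at x ≢ y matter.

ETree : ℕ → ℕ → Set
ETree n k = Tree (Subset (suc k)) (Fin (suc n))

EMap : ℕ → ℕ → Set
EMap n k = Fin (suc n) → Fin (suc n) → Subset (suc k)

-- the path from lca(x,y) to y contains an m-edge
HasMEdge : ∀ {n k} → ETree n k → Fin (suc n) → Fin (suc n) → Fin (suc k) → Set
HasMEdge t x y m =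
  Σ Path λ px → Σ Path λ py → Σ Path λ u → Σ Path λ v → Σ _ λ l →
    LeafPos t x px × LeafPos t y py × IsLCA t (px ∷ py ∷ []) u ×
    u ≺ v × v ⪯ py × Lab t v l × m ∈ l

Explains : ∀ {n k} → ETree n k → EMap n k → Set
Explains t ε = ∀ x y → x ≢ y → ∀ m →
  (m ∈ ε x y → HasMEdge t x y m) × (HasMEdge t x y m → m ∈ ε x y)

FitchMap : ∀ {n k} → EMap n k → Set
FitchMap {n} {k} ε = Σ (ETree n k) (λ T → Phylo T × Explains T ε)

InN : ∀ {n k} → EMap n k → Fin (suc k) → Fin (suc n) → Fin (suc n) → Set
InN ε m y x = x ≡ y ⊎ (x ≢ y × m ∉ ε x y)

ℛ : ∀ {n k} → EMap n k → TripleSet (Fin (suc n))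
ℛ ε a b c = a ≢ b × Σ _ λ y → Σ _ λ m →
  InN ε m y a × InN ε m y b × (InN ε m y c → Data.Empty.⊥)
  where import Data.Empty

-- In a tree explaining ε, N_m[y] is the set of leaves below the deepest vertex on the
-- path from the root to y whose incoming edge carries m (the root if there is none).
-- So every N ∈ 𝒩[ε] is a cluster, and a cluster containing a and b but not c forces
-- ab|c; this gives (1), and applied to the underlying unlabelled tree, compatibility.
-- For closedness, let ab|c be in the closure but not in ℛ(ε), and let t be a
-- phylogenetic tree in which every N ∈ 𝒩[ε] is a cluster.  Then t displays ab|c, so
-- lca(a,b) is an inner non-root vertex whose cluster contains a and b but not c, and
-- therefore lies outside 𝒩[ε].  Contracting its incoming edge yields a smaller tree
-- with the same two properties, and this descent cannot go on forever.

module Submission where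

open import Defs
open import Data.Empty using (⊥; ⊥-elim)
open import Data.Fin using (Fin) renaming (_≟_ to _≟ᶠ_)
open import Data.Fin.Properties using (any?)
open import Data.Fin.Subset using (_∈_; _∉_)
open import Data.Fin.Subset.Properties using (_∈?_)
open import Data.List using (List; []; _∷_; _++_; length)
open import Data.List.Properties using (++-assoc; ++-identityʳ; ++-identityʳ-unique; length-++)
open import Data.List.Relation.Unary.All using ([]; _∷_)
open import Data.Maybe using (Maybe; just; nothing)
open import Data.Maybe.Properties using (just-injective)
open import Data.Nat using (ℕ; zero; suc; _≤_; _<_; _+_; z≤n; s≤s)
open import Data.Nat.Induction using (<-wellFounded)
open import Data.Nat.Properties
open import Data.Product using (Σ; ∃; _×_; _,_; proj₁; proj₂)
open import Data.Product.Properties using (,-injectiveˡ; ,-injectiveʳ)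
open import Data.Sum using (_⊎_; inj₁; inj₂; map₁; [_,_]′) renaming (map to ⊎-map)
open import Data.Unit using (⊤; tt)
open import Function using (_∘_; const)
open import Function.Bundles using (_⇔_; mk⇔; Equivalence)
open import Induction.WellFounded using (Acc; acc)
open import Relation.Binary.Definitions using (DecidableEquality)
open import Relation.Binary.PropositionalEquality
open import Relation.Nullary using (¬_; Dec; yes; no; contradiction)
open import Relation.Nullary.Decidable using (_×-dec_; _⊎-dec_; ¬?; map′)
open import Relation.Unary using (Decidable)

open Equivalence using (to; from)

-- Paths and the ancestor order

⪯-refl : ∀ p → p ⪯ p
⪯-refl p = [] , ++-identityʳ p

⪯-trans : ∀ {p q r} → p ⪯ q → q ⪯ r → p ⪯ r
⪯-trans {p} (s , refl) (s′ , refl) = s ++ s′ , sym (++-assoc p s s′)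

[]⪯ : ∀ p → [] ⪯ p
[]⪯ p = p , refl

∷⁺-⪯ : ∀ {i p q} → p ⪯ q → (i ∷ p) ⪯ (i ∷ q)
∷⁺-⪯ (s , refl) = s , refl

∷⁻-⪯ : ∀ {i j p q} → (i ∷ p) ⪯ (j ∷ q) → i ≡ j × p ⪯ q
∷⁻-⪯ (s , refl) = refl , s , refl

⪯[]⇒≡[] : ∀ {p} → p ⪯ [] → p ≡ []
⪯[]⇒≡[] {[]} _ = refl
⪯[]⇒≡[] {_ ∷ _} (_ , ())

⪯⇒≡⊎≺ : ∀ {p q} → p ⪯ q → p ≡ q ⊎ p ≺ q
⪯⇒≡⊎≺ {p} ([] , refl) = inj₁ (sym (++-identityʳ p))
⪯⇒≡⊎≺ (i ∷ s , e) = inj₂ (i , s , e)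

≺⇒⋡ : ∀ {p q} → p ≺ q → ¬ q ⪯ p
≺⇒⋡ {p} (i , s , refl) (s′ , e) =
  contradiction (++-identityʳ-unique p (trans (sym e) (++-assoc p (i ∷ s) s′))) λ ()

⪯-comparable : ∀ {v w q} → v ⪯ q → w ⪯ q → v ⪯ w ⊎ w ⪯ v
⪯-comparable {[]} _ _ = inj₁ ([]⪯ _)
⪯-comparable {_ ∷ _} {[]} _ _ = inj₂ ([]⪯ _)
⪯-comparable {_ ∷ _} {_ ∷ _} {[]} (_ , ()) _
⪯-comparable {_ ∷ _} {_ ∷ _} {_ ∷ _} v⪯q w⪯q
  with refl , v⪯q′ ← ∷⁻-⪯ v⪯q | refl , w⪯q′ ← ∷⁻-⪯ w⪯q
  = ⊎-map ∷⁺-⪯ ∷⁺-⪯ (⪯-comparable v⪯q′ w⪯q′)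

lcp : Path → Path → Path
lcp (i ∷ p) (j ∷ q) with i ≟ j
... | yes _ = i ∷ lcp p q
... | no _  = []
lcp _ _ = []

lcp-⪯ˡ : ∀ p q → lcp p q ⪯ p
lcp-⪯ˡ [] _ = []⪯ []
lcp-⪯ˡ (_ ∷ _) [] = []⪯ _
lcp-⪯ˡ (i ∷ p) (j ∷ q) with i ≟ j
... | yes _ = ∷⁺-⪯ (lcp-⪯ˡ p q)
... | no _  = []⪯ _

lcp-⪯ʳ : ∀ p q → lcp p q ⪯ q
lcp-⪯ʳ [] _ = []⪯ _
lcp-⪯ʳ (_ ∷ _) [] = []⪯ []
lcp-⪯ʳ (i ∷ p) (j ∷ q) with i ≟ j
... | yes refl = ∷⁺-⪯ (lcp-⪯ʳ p q)
... | no _     = []⪯ _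

lcp-greatest : ∀ {v p q} → v ⪯ p → v ⪯ q → v ⪯ lcp p q
lcp-greatest {[]} _ _ = []⪯ _
lcp-greatest {_ ∷ _} {[]} (_ , ()) _
lcp-greatest {_ ∷ _} {_ ∷ _} {[]} _ (_ , ())
lcp-greatest {k ∷ _} {_ ∷ _} {_ ∷ _} v⪯p v⪯q
  with refl , v⪯p′ ← ∷⁻-⪯ v⪯p | refl , v⪯q′ ← ∷⁻-⪯ v⪯q | k ≟ k
... | yes _   = ∷⁺-⪯ (lcp-greatest v⪯p′ v⪯q′)
... | no k≢k = contradiction refl k≢k

Deepest : (Path → Set) → Path → Path → Set
Deepest D q p = p ⪯ q × (p ≡ [] ⊎ D p) × (∀ v → v ⪯ q → D v → v ⪯ p)

private
  below-∷ : ∀ {D : Path → Set} {i q p} → (∀ v → v ⪯ q → D (i ∷ v) → v ⪯ p) →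
            ∀ v → v ⪯ (i ∷ q) → D v → v ⪯ (i ∷ p)
  below-∷ _ [] _ _ = []⪯ _
  below-∷ below (_ ∷ v) v⪯iq Dv with refl , v⪯q ← ∷⁻-⪯ v⪯iq = ∷⁺-⪯ (below v v⪯q Dv)

deepest-prefix : ∀ {D} → Decidable D → ∀ q → ∃ (Deepest D q)
deepest-prefix _ [] = [] , ⪯-refl [] , inj₁ refl , λ _ v⪯[] _ → v⪯[]
deepest-prefix {D} D? (i ∷ q) with deepest-prefix {D ∘ (i ∷_)} (D? ∘ (i ∷_)) q
... | p , p⪯q , inj₂ Dip , below = i ∷ p , ∷⁺-⪯ p⪯q , inj₂ Dip , below-∷ below
... | _ , _ , inj₁ refl , below with D? (i ∷ [])
...   | yes Di = i ∷ [] , ∷⁺-⪯ ([]⪯ q) , inj₂ Di , below-∷ below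
...   | no ¬Di = [] , []⪯ _ , inj₁ refl , none-below
  where
    none-below : ∀ v → v ⪯ (i ∷ q) → D v → v ⪯ []
    none-below [] _ _ = ⪯-refl []
    none-below (_ ∷ v) v⪯iq Dv with refl , v⪯q ← ∷⁻-⪯ v⪯iq with refl ← ⪯[]⇒≡[] (below v v⪯q Dv) =
      contradiction Dv ¬Di

≡just-unique : ∀ {A : Set} {m : Maybe A} {a a′} → m ≡ just a → m ≡ just a′ → a ≡ a′
≡just-unique e e′ = just-injective (trans (sym e) e′)

-- Trees with leaf counts

module Trees {X : Set} (_≟ₓ_ : DecidableEquality X) where

  private variable
    L L′ : Set
    l : L
    x y a b c : X
    i j : ℕ
    p q q′ r w : Path
    t s s′ u : Tree L X
    cs ds : List (L × Tree L X)
    N : X → Set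

  Sub-functional : Sub t p s → Sub t p s′ → s ≡ s′
  Sub-functional here here = refl
  Sub-functional (there e p↓) (there e′ p↓′) with refl ← ≡just-unique e e′ = Sub-functional p↓ p↓′

  Sub-++ : Sub t p s → Sub s r u → Sub t (p ++ r) u
  Sub-++ here r↓ = r↓
  Sub-++ (there e p↓) r↓ = there e (Sub-++ p↓ r↓)

  Sub-++⁻ : ∀ p → Sub t (p ++ r) u → ∃ λ s → Sub t p s × Sub s r u
  Sub-++⁻ [] r↓ = _ , here , r↓
  Sub-++⁻ (_ ∷ p) (there e pr↓) with s , p↓ , r↓ ← Sub-++⁻ p pr↓ = s , there e p↓ , r↓

  Sub-suc : ∀ {e} → Sub (node cs) (i ∷ p) s → Sub (node (e ∷ cs)) (suc i ∷ p) s
  Sub-suc (there e p↓) = there e p↓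

  ⪯-Vertex : p ⪯ q → Sub t q u → Vertex t p
  ⪯-Vertex {p = p} (_ , refl) q↓ = let s , p↓ , _ = Sub-++⁻ p q↓ in s , p↓

  leafCount : X → X → ℕ
  leafCount x y with x ≟ₓ y
  ... | yes _ = 1
  ... | no _  = 0

  leafCount≤1 : ∀ x y → leafCount x y ≤ 1
  leafCount≤1 x y with x ≟ₓ y
  ... | yes _ = ≤-refl
  ... | no _  = z≤n

  leafCount-self : ∀ x → 1 ≤ leafCount x x
  leafCount-self x with x ≟ₓ x
  ... | yes _   = ≤-refl
  ... | no x≢x = contradiction refl x≢x

  leafCount-pos⇒≡ : ∀ x y → 1 ≤ leafCount x y → x ≡ y
  leafCount-pos⇒≡ x y x∈y with x ≟ₓ y | x∈y
  ... | yes x≡y | _ = x≡y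
  ... | no _    | ()

  mutual
    count : X → Tree L X → ℕ
    count x (leaf y) = leafCount x y
    count x (node cs) = countᶜ x cs

    countᶜ : X → List (L × Tree L X) → ℕ
    countᶜ x [] = 0
    countᶜ x ((_ , c) ∷ cs) = count x c + countᶜ x cs

  infix 4 _∈ᴸ_ _∈ᴸ?_

  _∈ᴸ_ : X → Tree L X → Set
  x ∈ᴸ s = 1 ≤ count x s

  _∈ᴸ?_ : ∀ x (s : Tree L X) → Dec (x ∈ᴸ s)
  x ∈ᴸ? s = 1 ≤? count x s

  ∉ᴸ⇒count≡0 : ∀ (s : Tree L X) → ¬ x ∈ᴸ s → count x s ≡ 0
  ∉ᴸ⇒count≡0 _ x∉s = n<1⇒n≡0 (≰⇒> x∉s)

  count-child≤ : ∀ (cs : List (L × Tree L X)) i → nth cs i ≡ just (l , s) → count x s ≤ countᶜ x cs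
  count-child≤ [] _ ()
  count-child≤ (_ ∷ _) zero refl = m≤m+n _ _
  count-child≤ ((_ , c) ∷ cs) (suc i) e = m≤n⇒m≤o+n (count _ c) (count-child≤ cs i e)

  Sub⇒∈ᴸ : Sub s r (leaf x) → x ∈ᴸ s
  Sub⇒∈ᴸ {x = x} here = leafCount-self x
  Sub⇒∈ᴸ (there {cs = cs} {i = i} e r↓) = ≤-trans (Sub⇒∈ᴸ r↓) (count-child≤ cs i e)

  mutual
    ∈ᴸ⇒Sub : ∀ (s : Tree L X) → x ∈ᴸ s → ∃ λ r → Sub s r (leaf x)
    ∈ᴸ⇒Sub {x = x} (leaf y) x∈y with refl ← leafCount-pos⇒≡ x y x∈y = [] , here
    ∈ᴸ⇒Sub (node cs) x∈cs = let i , r , r↓ = ∈ᴸ⇒Subᶜ cs x∈cs in i ∷ r , r↓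

    ∈ᴸ⇒Subᶜ : ∀ (cs : List (L × Tree L X)) → 1 ≤ countᶜ x cs →
              ∃ λ i → ∃ λ r → Sub (node cs) (i ∷ r) (leaf x)
    ∈ᴸ⇒Subᶜ [] ()
    ∈ᴸ⇒Subᶜ {x = x} ((_ , c) ∷ cs) x∈ with x ∈ᴸ? c
    ... | yes x∈c = let r , r↓ = ∈ᴸ⇒Sub c x∈c in zero , r , there refl r↓
    ... | no x∉c =
      let i , r , r↓ = ∈ᴸ⇒Subᶜ cs (subst (λ n → 1 ≤ n + countᶜ x cs) (∉ᴸ⇒count≡0 c x∉c) x∈)
      in suc i , r , Sub-suc r↓

  LeafUnique : X → Tree L X → Set
  LeafUnique x t = ∀ {q q′} → Sub t q (leaf x) → Sub t q′ (leaf x) → q ≡ q′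

  private
    ∈ᴸ-head-and-tail : count x s + countᶜ x cs ≤ 1 →
                       Sub s r (leaf x) → Sub (node cs) q (leaf x) → ⊥
    ∈ᴸ-head-and-tail bound r↓ q↓ =
      <-irrefl refl (≤-trans (+-mono-≤ (Sub⇒∈ᴸ r↓) (Sub⇒∈ᴸ q↓)) bound)

  mutual
    count≤1⇒LeafUnique : ∀ (t : Tree L X) → count x t ≤ 1 → LeafUnique x t
    count≤1⇒LeafUnique (leaf _) _ here here = refl
    count≤1⇒LeafUnique (node cs) bound (there e r↓) (there e′ r↓′) =
      count≤1⇒LeafUniqueᶜ cs bound e r↓ e′ r↓′

    count≤1⇒LeafUniqueᶜ : ∀ (cs : List (L × Tree L X)) {i j l l′ s s′ r r′} → countᶜ x cs ≤ 1 →
      nth cs i ≡ just (l , s) → Sub s r (leaf x) →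
      nth cs j ≡ just (l′ , s′) → Sub s′ r′ (leaf x) → i ∷ r ≡ j ∷ r′
    count≤1⇒LeafUniqueᶜ [] _ ()
    count≤1⇒LeafUniqueᶜ ((_ , c) ∷ _) {zero} {zero} bound refl r↓ refl r↓′ =
      cong (zero ∷_) (count≤1⇒LeafUnique c (m+n≤o⇒m≤o _ bound) r↓ r↓′)
    count≤1⇒LeafUniqueᶜ (_ ∷ cs) {zero} {suc _} bound refl r↓ e′ r↓′ =
      ⊥-elim (∈ᴸ-head-and-tail bound r↓ (there {cs = cs} e′ r↓′))
    count≤1⇒LeafUniqueᶜ (_ ∷ cs) {suc _} {zero} bound e r↓ refl r↓′ =
      ⊥-elim (∈ᴸ-head-and-tail bound r↓′ (there {cs = cs} e r↓))
    count≤1⇒LeafUniqueᶜ ((_ , c) ∷ cs) {suc _} {suc _} bound e r↓ e′ r↓′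
      with refl ← count≤1⇒LeafUniqueᶜ cs (m+n≤o⇒n≤o (count _ c) bound) e r↓ e′ r↓′ = refl

  LeafUnique-head : LeafUnique x (node ((l , s) ∷ cs)) → LeafUnique x s
  LeafUnique-head unique q↓ q↓′
    with refl ← unique (there {i = zero} refl q↓) (there {i = zero} refl q↓′) = refl

  LeafUnique-tail : ∀ {e} → LeafUnique x (node (e ∷ cs)) → LeafUnique x (node cs)
  LeafUnique-tail unique (there e q↓) (there e′ q↓′)
    with refl ← unique (there {i = suc _} e q↓) (there {i = suc _} e′ q↓′) = refl

  mutual
    LeafUnique⇒count≤1 : ∀ (t : Tree L X) → LeafUnique x t → count x t ≤ 1
    LeafUnique⇒count≤1 {x = x} (leaf y) _ = leafCount≤1 x y
    LeafUnique⇒count≤1 (node cs) unique = LeafUnique⇒count≤1ᶜ cs unique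

    LeafUnique⇒count≤1ᶜ : ∀ (cs : List (L × Tree L X)) → LeafUnique x (node cs) → countᶜ x cs ≤ 1
    LeafUnique⇒count≤1ᶜ [] _ = z≤n
    LeafUnique⇒count≤1ᶜ {x = x} ((_ , c) ∷ cs) unique with x ∈ᴸ? c
    ... | no x∉c =
      +-mono-≤ (≤-reflexive (∉ᴸ⇒count≡0 c x∉c)) (LeafUnique⇒count≤1ᶜ cs (LeafUnique-tail unique))
    ... | yes x∈c =
      +-mono-≤ (LeafUnique⇒count≤1 c (LeafUnique-head unique)) (≤-reflexive (∉ᴸ⇒count≡0 (node cs) x∉cs))
      where
        x∉cs : ¬ x ∈ᴸ node cs
        x∉cs x∈cs =
          let r , r↓ = ∈ᴸ⇒Sub c x∈c
              _ , r′ , r↓′ = ∈ᴸ⇒Subᶜ cs x∈cs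
          in contradiction (unique (there {i = zero} refl r↓) (Sub-suc r↓′)) λ ()

  -- Phylogenetic trees, clusters and displayed triples

  mutual
    Wide : Tree L X → Set
    Wide (leaf _) = ⊤
    Wide (node cs) = 2 ≤ length cs × Wideᶜ cs

    Wideᶜ : List (L × Tree L X) → Set
    Wideᶜ [] = ⊤
    Wideᶜ ((_ , c) ∷ cs) = Wide c × Wideᶜ cs

  Branching : Tree L X → Set
  Branching {L = L} t = ∀ p (cs : List (L × Tree L X)) → Sub t p (node cs) → 2 ≤ length cs

  Wide-child : ∀ (cs : List (L × Tree L X)) i → Wideᶜ cs → nth cs i ≡ just (l , s) → Wide s
  Wide-child [] _ _ ()
  Wide-child (_ ∷ _) zero (wide , _) refl = wide
  Wide-child (_ ∷ cs) (suc i) (_ , wide) e = Wide-child cs i wide e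

  Wide⇒Branching : Wide t → Branching t
  Wide⇒Branching (wide , _) _ _ here = wide
  Wide⇒Branching {t = node cs} (_ , wide) _ _ (there {i = i} e p↓) =
    Wide⇒Branching (Wide-child cs i wide e) _ _ p↓

  mutual
    Branching⇒Wide : ∀ (t : Tree L X) → Branching t → Wide t
    Branching⇒Wide (leaf _) _ = tt
    Branching⇒Wide (node cs) branching =
      branching [] cs here ,
      Branching⇒Wideᶜ cs (λ i e p ds p↓ → branching (i ∷ p) ds (there e p↓))

    Branching⇒Wideᶜ : ∀ (cs : List (L × Tree L X)) →
      (∀ i {l s} → nth cs i ≡ just (l , s) → Branching s) → Wideᶜ cs
    Branching⇒Wideᶜ [] _ = tt
    Branching⇒Wideᶜ ((_ , c) ∷ cs) branching =
      Branching⇒Wide c (branching zero refl) , Branching⇒Wideᶜ cs (λ i → branching (suc i))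

  -- Phylo, restated in a form that edge contraction visibly preserves.
  Phyloᶜ : Tree L X → Set
  Phyloᶜ t = IsNode t × Wide t × (∀ x → count x t ≡ 1)

  Phyloᶜ⇒Phylo : Phyloᶜ t → Phylo t
  Phyloᶜ⇒Phylo {t = t} (t-node , wide , once) = t-node , Wide⇒Branching wide , λ x →
    let q , q↓ = ∈ᴸ⇒Sub t (≤-reflexive (sym (once x)))
    in q , q↓ , λ q′ q′↓ → count≤1⇒LeafUnique t (≤-reflexive (once x)) q′↓ q↓

  Phylo⇒Phyloᶜ : Phylo t → Phyloᶜ t
  Phylo⇒Phyloᶜ {t = t} (t-node , branching , leaves) = t-node , Branching⇒Wide t branching , λ x →
    let _ , q↓ , unique = leaves x
    in ≤-antisym (LeafUnique⇒count≤1 t λ r↓ r↓′ → trans (unique _ r↓) (sym (unique _ r↓′)))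
                 (Sub⇒∈ᴸ q↓)

  leafPos : Phylo t → X → Path
  leafPos (_ , _ , leaves) x = proj₁ (leaves x)

  leafPos-LeafPos : (ph : Phylo t) → ∀ x → LeafPos t x (leafPos ph x)
  leafPos-LeafPos (_ , _ , leaves) x = proj₁ (proj₂ (leaves x))

  LeafPos-unique : Phylo t → LeafPos t x q → LeafPos t x q′ → q ≡ q′
  LeafPos-unique {x = x} (_ , _ , leaves) q↓ q↓′ =
    let _ , _ , unique = leaves x in trans (unique _ q↓) (sym (unique _ q↓′))

  ⪯⇒∈ᴸ : Sub t p s → LeafPos t x q → p ⪯ q → x ∈ᴸ s
  ⪯⇒∈ᴸ {p = p} p↓ x↓ (_ , refl) with _ , p↓′ , r↓ ← Sub-++⁻ p x↓ with refl ← Sub-functional p↓ p↓′ =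
    Sub⇒∈ᴸ r↓

  ∈ᴸ⇒⪯ : Phylo t → Sub t p s → LeafPos t x q → x ∈ᴸ s → p ⪯ q
  ∈ᴸ⇒⪯ {s = s} ph p↓ x↓ x∈s = let r , r↓ = ∈ᴸ⇒Sub s x∈s in r , LeafPos-unique ph (Sub-++ p↓ r↓) x↓

  IsCluster : Tree L X → (X → Set) → Set
  IsCluster {L = L} t N = Σ Path λ p → Σ (Tree L X) λ s → Sub t p s × (∀ x → N x ⇔ x ∈ᴸ s)

  Separates : Tree L X → X → X → X → Set
  Separates s a b c = a ∈ᴸ s × b ∈ᴸ s × ¬ c ∈ᴸ s

  lcp-IsLCA₂ : Sub t p s → IsLCA t (p ∷ q ∷ []) (lcp p q)
  lcp-IsLCA₂ {p = p} {q = q} p↓ =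
    ⪯-Vertex (lcp-⪯ˡ p q) p↓ , lcp-⪯ˡ p q ∷ lcp-⪯ʳ p q ∷ [] ,
    λ { _ _ (v⪯p ∷ v⪯q ∷ []) → lcp-greatest v⪯p v⪯q }

  lcp-IsLCA₃ : Sub t p s → IsLCA t (p ∷ q ∷ r ∷ []) (lcp p (lcp q r))
  lcp-IsLCA₃ {p = p} {q = q} {r = r} p↓ =
    ⪯-Vertex (lcp-⪯ˡ p _) p↓ ,
    lcp-⪯ˡ p _ ∷ ⪯-trans (lcp-⪯ʳ p _) (lcp-⪯ˡ q r) ∷ ⪯-trans (lcp-⪯ʳ p _) (lcp-⪯ʳ q r) ∷ [] ,
    λ { _ _ (v⪯p ∷ v⪯q ∷ v⪯r ∷ []) → lcp-greatest v⪯p (lcp-greatest v⪯q v⪯r) }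

  cluster⇒displays : Phylo t → Sub t p s → Separates s a b c → a ≢ b → Displays t a b c
  cluster⇒displays {t = t} {p = p} {a = a} {b = b} {c = c} ph p↓ (a∈s , b∈s , c∉s) a≢b =
    a≢b , (λ { refl → c∉s a∈s }) , (λ { refl → c∉s b∈s }) ,
    pa , pb , pc , lcp pa (lcp pb pc) , lcp pa pb , a↓ , b↓ , c↓ ,
    lcp-IsLCA₃ a↓ , lcp-IsLCA₂ a↓ , abc≺ab
    where
      pa pb pc : Path
      pa = leafPos ph a
      pb = leafPos ph b
      pc = leafPos ph c
      a↓ : LeafPos t a pa
      a↓ = leafPos-LeafPos ph a
      b↓ : LeafPos t b pb
      b↓ = leafPos-LeafPos ph b
      c↓ : LeafPos t c pc
      c↓ = leafPos-LeafPos ph c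
      p⪯ab : p ⪯ lcp pa pb
      p⪯ab = lcp-greatest (∈ᴸ⇒⪯ ph p↓ a↓ a∈s) (∈ᴸ⇒⪯ ph p↓ b↓ b∈s)
      abc⪯c : lcp pa (lcp pb pc) ⪯ pc
      abc⪯c = ⪯-trans (lcp-⪯ʳ pa _) (lcp-⪯ʳ pb pc)
      abc≺ab : lcp pa (lcp pb pc) ≺ lcp pa pb
      abc≺ab with ⪯⇒≡⊎≺ (lcp-greatest (lcp-⪯ˡ pa _) (⪯-trans (lcp-⪯ʳ pa _) (lcp-⪯ˡ pb pc)))
      ... | inj₂ abc≺ab = abc≺ab
      ... | inj₁ abc≡ab = contradiction (⪯⇒∈ᴸ p↓ c↓ (⪯-trans p⪯ab (subst (_⪯ pc) abc≡ab abc⪯c))) c∉s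

  displays⇒separating-vertex : Phylo t → Displays t a b c →
    ∃ λ i → ∃ λ w → ∃ λ ds → Sub t (i ∷ w) (node ds) × Separates (node ds) a b c
  displays⇒separating-vertex {t = t} {a = a} {b = b} {c = c} ph
    (a≢b , _ , _ , pa , pb , pc , u , w , a↓ , b↓ , c↓ , (_ , _ , abc-greatest) ,
     ((s , w↓) , w⪯a ∷ w⪯b ∷ [] , _) , u≺w) = separating w s w↓ w⪯a w⪯b u≺w
    where
      separating : ∀ w s → Sub t w s → w ⪯ pa → w ⪯ pb → u ≺ w →
        ∃ λ i → ∃ λ w → ∃ λ ds → Sub t (i ∷ w) (node ds) × Separates (node ds) a b c
      separating [] _ _ _ _ u≺[] = contradiction ([]⪯ u) (≺⇒⋡ u≺[])
      separating (_ ∷ _) (leaf z) w↓ w⪯a w⪯b _ =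
        contradiction (trans (leafCount-pos⇒≡ a z (⪯⇒∈ᴸ w↓ a↓ w⪯a))
                             (sym (leafCount-pos⇒≡ b z (⪯⇒∈ᴸ w↓ b↓ w⪯b)))) a≢b
      separating (i ∷ w) (node ds) w↓ w⪯a w⪯b u≺w =
        i , w , ds , w↓ , ⪯⇒∈ᴸ w↓ a↓ w⪯a , ⪯⇒∈ᴸ w↓ b↓ w⪯b ,
        λ c∈w → ≺⇒⋡ u≺w (abc-greatest _ (_ , w↓) (w⪯a ∷ w⪯b ∷ ∈ᴸ⇒⪯ ph w↓ c↓ c∈w ∷ []))

  EdgeSatisfies : (L → Set) → Tree L X → Path → Set
  EdgeSatisfies P t v = ∃ λ l → Lab t v l × P l

  module _ {P : L → Set} (P? : Decidable P) where
    mutual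
      edge? : ∀ (t : Tree L X) v → Dec (EdgeSatisfies P t v)
      edge? (leaf _) _ = no λ { (_ , () , _) }
      edge? (node _) [] = no λ { (_ , () , _) }
      edge? (node cs) (i ∷ v) = child-edge? cs i (nth cs i) refl v

      child-edge? : ∀ cs i m → nth cs i ≡ m → ∀ v → Dec (EdgeSatisfies P (node cs) (i ∷ v))
      child-edge? _ _ nothing eq [] =
        no λ { (_ , lab-top e , _) → contradiction (trans (sym eq) e) λ () }
      child-edge? _ _ nothing eq (_ ∷ _) =
        no λ { (_ , lab-deep e _ , _) → contradiction (trans (sym eq) e) λ () }
      child-edge? _ _ (just (l , _)) eq [] =
        map′ (λ Pl → l , lab-top eq , Pl)
             (λ { (_ , lab-top e , Pl) → subst P (,-injectiveˡ (≡just-unique e eq)) Pl })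
             (P? l)
      child-edge? _ _ (just (_ , c)) eq (j ∷ v) =
        map′ (λ (l , lab , Pl) → l , lab-deep eq lab , Pl)
             (λ { (l , lab-deep e lab , Pl) →
                  l , subst (λ c → Lab c (j ∷ v) l) (,-injectiveʳ (≡just-unique e eq)) lab , Pl })
             (edge? c (j ∷ v))

  -- Edge contraction

  inline : ℕ → List (L × Tree L X) → List (L × Tree L X)
  inline _ [] = []
  inline zero ((l , leaf x) ∷ cs) = (l , leaf x) ∷ cs
  inline zero ((_ , node ds) ∷ cs) = ds ++ cs
  inline (suc i) (e ∷ cs) = e ∷ inline i cs

  -- contract (i ∷ w) t suppresses the inner vertex at i ∷ w, attaching its children to
  -- its parent; at a leaf, at the root or at a path outside t it changes nothing.
  mutual
    contract : Path → Tree L X → Tree L X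
    contract [] t = t
    contract (_ ∷ _) (leaf x) = leaf x
    contract (i ∷ []) (node cs) = node (inline i cs)
    contract (i ∷ j ∷ p) (node cs) = node (contractᶜ i (j ∷ p) cs)

    contractᶜ : ℕ → Path → List (L × Tree L X) → List (L × Tree L X)
    contractᶜ _ _ [] = []
    contractᶜ zero p ((l , c) ∷ cs) = (l , contract p c) ∷ cs
    contractᶜ (suc i) p (e ∷ cs) = e ∷ contractᶜ i p cs

  countᶜ-++ : ∀ x (ds cs : List (L × Tree L X)) → countᶜ x (ds ++ cs) ≡ countᶜ x ds + countᶜ x cs
  countᶜ-++ x [] cs = refl
  countᶜ-++ x ((_ , d) ∷ ds) cs =
    trans (cong (count x d +_) (countᶜ-++ x ds cs)) (sym (+-assoc (count x d) _ _))

  countᶜ-inline : ∀ x i (cs : List (L × Tree L X)) → countᶜ x (inline i cs) ≡ countᶜ x cs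
  countᶜ-inline x _ [] = refl
  countᶜ-inline x zero ((_ , leaf _) ∷ _) = refl
  countᶜ-inline x zero ((_ , node ds) ∷ cs) = countᶜ-++ x ds cs
  countᶜ-inline x (suc i) ((_ , c) ∷ cs) = cong (count x c +_) (countᶜ-inline x i cs)

  mutual
    count-contract : ∀ x p (t : Tree L X) → count x (contract p t) ≡ count x t
    count-contract x [] t = refl
    count-contract x (_ ∷ _) (leaf _) = refl
    count-contract x (i ∷ []) (node cs) = countᶜ-inline x i cs
    count-contract x (i ∷ j ∷ p) (node cs) = countᶜ-contract x i (j ∷ p) cs

    countᶜ-contract : ∀ x i p (cs : List (L × Tree L X)) → countᶜ x (contractᶜ i p cs) ≡ countᶜ x cs
    countᶜ-contract x _ _ [] = refl
    countᶜ-contract x zero p ((_ , c) ∷ cs) = cong (_+ countᶜ x cs) (count-contract x p c)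
    countᶜ-contract x (suc i) p ((_ , c) ∷ cs) = cong (count x c +_) (countᶜ-contract x i p cs)

  Wideᶜ-++ : ∀ (ds cs : List (L × Tree L X)) → Wideᶜ ds → Wideᶜ cs → Wideᶜ (ds ++ cs)
  Wideᶜ-++ [] _ _ wide = wide
  Wideᶜ-++ (_ ∷ ds) cs (wide₁ , wide₂) wide = wide₁ , Wideᶜ-++ ds cs wide₂ wide

  Wideᶜ-inline : ∀ i (cs : List (L × Tree L X)) → Wideᶜ cs → Wideᶜ (inline i cs)
  Wideᶜ-inline _ [] wide = wide
  Wideᶜ-inline zero ((_ , leaf _) ∷ _) wide = wide
  Wideᶜ-inline zero ((_ , node ds) ∷ cs) ((_ , wide-ds) , wide) = Wideᶜ-++ ds cs wide-ds wide
  Wideᶜ-inline (suc i) (_ ∷ cs) (wide₁ , wide) = wide₁ , Wideᶜ-inline i cs wide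

  length-inline : ∀ i (cs : List (L × Tree L X)) → Wideᶜ cs → length cs ≤ length (inline i cs)
  length-inline _ [] _ = z≤n
  length-inline zero ((_ , leaf _) ∷ _) _ = ≤-refl
  length-inline zero ((_ , node ds) ∷ cs) ((2≤ds , _) , _) = begin
    suc (length cs)         ≤⟨ +-monoˡ-≤ (length cs) (≤-trans (s≤s z≤n) 2≤ds) ⟩
    length ds + length cs   ≡⟨ length-++ ds ⟨
    length (ds ++ cs)       ∎
    where open ≤-Reasoning
  length-inline (suc i) (_ ∷ cs) (_ , wide) = s≤s (length-inline i cs wide)

  length-contractᶜ : ∀ i p (cs : List (L × Tree L X)) → length (contractᶜ i p cs) ≡ length cs
  length-contractᶜ _ _ [] = refl
  length-contractᶜ zero _ (_ ∷ _) = refl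
  length-contractᶜ (suc i) p (_ ∷ cs) = cong suc (length-contractᶜ i p cs)

  mutual
    Wide-contract : ∀ p (t : Tree L X) → Wide t → Wide (contract p t)
    Wide-contract [] _ wide = wide
    Wide-contract (_ ∷ _) (leaf _) wide = wide
    Wide-contract (i ∷ []) (node cs) (2≤cs , wide) =
      ≤-trans 2≤cs (length-inline i cs wide) , Wideᶜ-inline i cs wide
    Wide-contract (i ∷ j ∷ p) (node cs) (2≤cs , wide) =
      subst (2 ≤_) (sym (length-contractᶜ i (j ∷ p) cs)) 2≤cs , Wideᶜ-contract i (j ∷ p) cs wide

    Wideᶜ-contract : ∀ i p (cs : List (L × Tree L X)) → Wideᶜ cs → Wideᶜ (contractᶜ i p cs)
    Wideᶜ-contract _ _ [] wide = wide
    Wideᶜ-contract zero p ((_ , c) ∷ _) (wide₁ , wide) = Wide-contract p c wide₁ , wide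
    Wideᶜ-contract (suc i) p (_ ∷ cs) (wide₁ , wide) = wide₁ , Wideᶜ-contract i p cs wide

  Phyloᶜ-contract : Sub t (i ∷ w) (node ds) → Phyloᶜ t → Phyloᶜ (contract (i ∷ w) t)
  Phyloᶜ-contract {t = node cs} {i = i} {w = w} _ (_ , wide , once) =
    node-contract w , Wide-contract (i ∷ w) (node cs) wide ,
    λ x → trans (count-contract x (i ∷ w) (node cs)) (once x)
    where
      node-contract : ∀ w → IsNode (contract (i ∷ w) (node cs))
      node-contract [] = isNode
      node-contract (_ ∷ _) = isNode

  mutual
    size : Tree L X → ℕ
    size (leaf _) = 1
    size (node cs) = suc (sizeᶜ cs)

    sizeᶜ : List (L × Tree L X) → ℕ
    sizeᶜ [] = 0
    sizeᶜ ((_ , c) ∷ cs) = size c + sizeᶜ cs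

  sizeᶜ-++ : ∀ (ds cs : List (L × Tree L X)) → sizeᶜ (ds ++ cs) ≡ sizeᶜ ds + sizeᶜ cs
  sizeᶜ-++ [] cs = refl
  sizeᶜ-++ ((_ , d) ∷ ds) cs =
    trans (cong (size d +_) (sizeᶜ-++ ds cs)) (sym (+-assoc (size d) _ _))

  sizeᶜ-inline : ∀ i (cs : List (L × Tree L X)) → nth cs i ≡ just (l , node ds) →
                 sizeᶜ (inline i cs) < sizeᶜ cs
  sizeᶜ-inline _ [] ()
  sizeᶜ-inline zero ((_ , node ds) ∷ cs) refl = ≤-reflexive (cong suc (sizeᶜ-++ ds cs))
  sizeᶜ-inline (suc i) ((_ , c) ∷ cs) e = +-monoʳ-< (size c) (sizeᶜ-inline i cs e)

  sizeᶜ-contract : ∀ i p (cs : List (L × Tree L X)) → nth cs i ≡ just (l , s) →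
                   size (contract p s) < size s → sizeᶜ (contractᶜ i p cs) < sizeᶜ cs
  sizeᶜ-contract _ _ [] ()
  sizeᶜ-contract zero _ (_ ∷ cs) refl smaller = +-monoˡ-< (sizeᶜ cs) smaller
  sizeᶜ-contract (suc i) p ((_ , c) ∷ cs) e smaller =
    +-monoʳ-< (size c) (sizeᶜ-contract i p cs e smaller)

  size-contract : Sub t (i ∷ w) (node ds) → size (contract (i ∷ w) t) < size t
  size-contract {t = node cs} {i = i} (there e here) = s≤s (sizeᶜ-inline i cs e)
  size-contract {t = node cs} {i = i} {w = j ∷ w} (there e w↓) =
    s≤s (sizeᶜ-contract i (j ∷ w) cs e (size-contract w↓))

  nth-++ˡ : ∀ {A : Set} (ds cs : List A) k {e} → nth ds k ≡ just e → nth (ds ++ cs) k ≡ just e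
  nth-++ˡ [] _ _ ()
  nth-++ˡ (_ ∷ _) _ zero e = e
  nth-++ˡ (_ ∷ ds) cs (suc k) e = nth-++ˡ ds cs k e

  nth-++ʳ : ∀ {A : Set} (ds cs : List A) k → nth (ds ++ cs) (length ds + k) ≡ nth cs k
  nth-++ʳ [] _ _ = refl
  nth-++ʳ (_ ∷ ds) cs k = nth-++ʳ ds cs k

  inline-grandchild : ∀ (cs : List (L × Tree L X)) i {k e} → nth cs i ≡ just (l , node ds) →
                      nth ds k ≡ just e → ∃ λ k′ → nth (inline i cs) k′ ≡ just e
  inline-grandchild [] _ ()
  inline-grandchild ((_ , node ds) ∷ cs) zero {k} refl e = k , nth-++ˡ ds cs k e
  inline-grandchild (_ ∷ cs) (suc i) e e′ = let k′ , e″ = inline-grandchild cs i e e′ in suc k′ , e″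

  inline-sibling : ∀ (cs : List (L × Tree L X)) {i j e} → j ≢ i → nth cs j ≡ just e →
                   ∃ λ j′ → nth (inline i cs) j′ ≡ just e
  inline-sibling [] _ ()
  inline-sibling (_ ∷ _) {zero} {zero} j≢i _ = contradiction refl j≢i
  inline-sibling ((_ , leaf _) ∷ _) {zero} {suc j} _ e = suc j , e
  inline-sibling ((_ , node ds) ∷ cs) {zero} {suc j} _ e = length ds + j , trans (nth-++ʳ ds cs j) e
  inline-sibling (_ ∷ _) {suc _} {zero} _ e = zero , e
  inline-sibling (_ ∷ cs) {suc i} {suc j} j≢i e =
    let j′ , e′ = inline-sibling cs (j≢i ∘ cong suc) e in suc j′ , e′

  contractᶜ-self : ∀ (cs : List (L × Tree L X)) i p → nth cs i ≡ just (l , s) →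
                   nth (contractᶜ i p cs) i ≡ just (l , contract p s)
  contractᶜ-self [] _ _ ()
  contractᶜ-self (_ ∷ _) zero _ refl = refl
  contractᶜ-self (_ ∷ cs) (suc i) p e = contractᶜ-self cs i p e

  contractᶜ-sibling : ∀ (cs : List (L × Tree L X)) {i j e} p → j ≢ i → nth cs j ≡ just e →
                      nth (contractᶜ i p cs) j ≡ just e
  contractᶜ-sibling [] _ _ ()
  contractᶜ-sibling (_ ∷ _) {zero} {zero} _ j≢i _ = contradiction refl j≢i
  contractᶜ-sibling (_ ∷ _) {zero} {suc _} _ _ e = e
  contractᶜ-sibling (_ ∷ _) {suc _} {zero} _ _ e = e
  contractᶜ-sibling (_ ∷ cs) {suc _} {suc _} p j≢i e = contractᶜ-sibling cs p (j≢i ∘ cong suc) e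

  HasVertexLike : Tree L X → Tree L X → Set
  HasVertexLike {L = L} t s =
    Σ Path λ p → Σ (Tree L X) λ s′ → Sub t p s′ × (∀ x → count x s′ ≡ count x s)

  inline-Sub : ∀ (cs : List (L × Tree L X)) {i} → nth cs i ≡ just (l , node ds) →
               Sub (node ds) p s → p ≡ [] ⊎ HasVertexLike (node (inline i cs)) s
  inline-Sub _ _ here = inj₁ refl
  inline-Sub cs e (there e′ p↓) =
    let k′ , e″ = inline-grandchild cs _ e e′ in inj₂ (k′ ∷ _ , _ , there e″ p↓ , λ _ → refl)

  contract-Sub : Sub t (i ∷ w) (node ds) → Sub t p s →
                 p ≡ i ∷ w ⊎ HasVertexLike (contract (i ∷ w) t) s
  contract-Sub {t = t} {i = i} {w = w} _ here =
    inj₂ ([] , _ , here , λ x → count-contract x (i ∷ w) t)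
  contract-Sub {t = node cs} {i = i} {w = []} (there e here) (there {i = j} e′ p↓) with j ≟ i
  ... | no j≢i =
    let j′ , e″ = inline-sibling cs j≢i e′ in inj₂ (j′ ∷ _ , _ , there e″ p↓ , λ _ → refl)
  ... | yes refl with refl ← ≡just-unique e e′ = map₁ (cong (i ∷_)) (inline-Sub cs e p↓)
  contract-Sub {t = node cs} {i = i} {w = k ∷ w} (there e w↓) (there {i = j} e′ p↓) with j ≟ i
  ... | no j≢i = inj₂ (j ∷ _ , _ , there (contractᶜ-sibling cs (k ∷ w) j≢i e′) p↓ , λ _ → refl)
  ... | yes refl with refl ← ≡just-unique e e′ with contract-Sub w↓ p↓
  ...   | inj₁ refl = inj₁ refl
  ...   | inj₂ (p′ , s′ , p′↓ , same) =
    inj₂ (i ∷ p′ , s′ , there (contractᶜ-self cs i (k ∷ w) e) p′↓ , same)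

  IsCluster-contract : Sub t (i ∷ w) (node ds) → IsCluster t N →
                       IsCluster (contract (i ∷ w) t) N ⊎ (∀ x → N x ⇔ x ∈ᴸ node ds)
  IsCluster-contract w↓ (_ , _ , p↓ , N⇔) with contract-Sub w↓ p↓
  ... | inj₁ refl with refl ← Sub-functional p↓ w↓ = inj₂ N⇔
  ... | inj₂ (p′ , s′ , p′↓ , same) =
    inj₁ (p′ , s′ , p′↓ , λ x → subst (λ n → _ ⇔ 1 ≤ n) (sym (same x)) (N⇔ x))

  module _ (f : L → L′) where
    mutual
      relabel : Tree L X → Tree L′ X
      relabel (leaf x) = leaf x
      relabel (node cs) = node (relabelᶜ cs)

      relabelᶜ : List (L × Tree L X) → List (L′ × Tree L′ X)
      relabelᶜ [] = []
      relabelᶜ ((l , c) ∷ cs) = (f l , relabel c) ∷ relabelᶜ cs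

    mutual
      count-relabel : ∀ x (t : Tree L X) → count x (relabel t) ≡ count x t
      count-relabel x (leaf _) = refl
      count-relabel x (node cs) = countᶜ-relabel x cs

      countᶜ-relabel : ∀ x (cs : List (L × Tree L X)) → countᶜ x (relabelᶜ cs) ≡ countᶜ x cs
      countᶜ-relabel x [] = refl
      countᶜ-relabel x ((_ , c) ∷ cs) = cong₂ _+_ (count-relabel x c) (countᶜ-relabel x cs)

    length-relabelᶜ : ∀ (cs : List (L × Tree L X)) → length (relabelᶜ cs) ≡ length cs
    length-relabelᶜ [] = refl
    length-relabelᶜ (_ ∷ cs) = cong suc (length-relabelᶜ cs)

    mutual
      Wide-relabel : ∀ (t : Tree L X) → Wide t → Wide (relabel t)
      Wide-relabel (leaf _) _ = tt
      Wide-relabel (node cs) (2≤cs , wide) =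
        subst (2 ≤_) (sym (length-relabelᶜ cs)) 2≤cs , Wideᶜ-relabel cs wide

      Wideᶜ-relabel : ∀ (cs : List (L × Tree L X)) → Wideᶜ cs → Wideᶜ (relabelᶜ cs)
      Wideᶜ-relabel [] _ = tt
      Wideᶜ-relabel ((_ , c) ∷ cs) (wide₁ , wide) = Wide-relabel c wide₁ , Wideᶜ-relabel cs wide

    nth-relabelᶜ : ∀ (cs : List (L × Tree L X)) i → nth cs i ≡ just (l , s) →
                   nth (relabelᶜ cs) i ≡ just (f l , relabel s)
    nth-relabelᶜ [] _ ()
    nth-relabelᶜ (_ ∷ _) zero refl = refl
    nth-relabelᶜ (_ ∷ cs) (suc i) e = nth-relabelᶜ cs i e

    Sub-relabel : Sub t p s → Sub (relabel t) p (relabel s)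
    Sub-relabel here = here
    Sub-relabel {t = node cs} (there {i = i} e p↓) = there (nth-relabelᶜ cs i e) (Sub-relabel p↓)

    Phyloᶜ-relabel : Phyloᶜ t → Phyloᶜ (relabel t)
    Phyloᶜ-relabel {t = node cs} (isNode , wide , once) =
      isNode , Wide-relabel (node cs) wide , λ x → trans (countᶜ-relabel x cs) (once x)

    IsCluster-relabel : IsCluster t N → IsCluster (relabel t) N
    IsCluster-relabel (p , s , p↓ , N⇔) =
      p , relabel s , Sub-relabel p↓ ,
      λ x → subst (λ n → _ ⇔ 1 ≤ n) (sym (count-relabel x s)) (N⇔ x)

-- Fitch maps

module Fitch {n k : ℕ} (ε : EMap n k) where
  open Trees (_≟ᶠ_ {suc n})

  private variable
    L : Set
    t : Tree L (Fin (suc n))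
    T : ETree n k
    a b c : Fin (suc n)

  InN? : ∀ m y x → Dec (InN ε m y x)
  InN? m y x = (x ≟ᶠ y) ⊎-dec (¬? (x ≟ᶠ y) ×-dec ¬? (m ∈? ε x y))

  ℛ? : ∀ a b c → Dec (ℛ ε a b c)
  ℛ? a b c = ¬? (a ≟ᶠ b) ×-dec
    any? λ y → any? λ m → InN? m y a ×-dec InN? m y b ×-dec ¬? (InN? m y c)

  𝒩⊆𝒞 : Tree L (Fin (suc n)) → Set
  𝒩⊆𝒞 t = ∀ y m → IsCluster t (InN ε m y)

  𝒩⊆𝒞⇒displays-ℛ : Phylo t → 𝒩⊆𝒞 t → DisplaysAll t (ℛ ε)
  𝒩⊆𝒞⇒displays-ℛ ph 𝒩t a b c (a≢b , y , m , a∈N , b∈N , c∉N) =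
    let _ , _ , p↓ , N⇔ = 𝒩t y m
    in cluster⇒displays ph p↓ (to (N⇔ a) a∈N , to (N⇔ b) b∈N , c∉N ∘ from (N⇔ c)) a≢b

  MEdge : ETree n k → Fin (suc k) → Path → Set
  MEdge T m = EdgeSatisfies (m ∈_) T

  deepest-m-edge-cluster : ∀ {m y p s} (ph : Phylo T) → Explains T ε →
    Deepest (MEdge T m) (leafPos ph y) p → Sub T p s → ∀ x → InN ε m y x ⇔ x ∈ᴸ s
  deepest-m-edge-cluster {T} {m} {y} {p} {s} ph explains (p⪯y , root-or-m-edge , deepest) p↓ x =
    mk⇔ N⇒∈ ∈⇒N
    where
      y↓ : LeafPos T y (leafPos ph y)
      y↓ = leafPos-LeafPos ph y
      x↓ : LeafPos T x (leafPos ph x)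
      x↓ = leafPos-LeafPos ph x

      p⪯x : x ≢ y → m ∉ ε x y → p ⪯ leafPos ph x
      p⪯x x≢y m∉ = [ (λ p≡[] → subst (_⪯ _) (sym p≡[]) ([]⪯ _)) , m-edge⪯x ]′ root-or-m-edge
        where
          m-edge⪯x : MEdge T m p → p ⪯ leafPos ph x
          m-edge⪯x (l , lab , m∈l) with ⪯-comparable p⪯y (lcp-⪯ʳ (leafPos ph x) _)
          ... | inj₁ p⪯u = ⪯-trans p⪯u (lcp-⪯ˡ _ _)
          ... | inj₂ u⪯p with ⪯⇒≡⊎≺ u⪯p
          ...   | inj₁ u≡p = subst (_⪯ _) u≡p (lcp-⪯ˡ _ _)
          ...   | inj₂ u≺p = contradiction
                    (proj₂ (explains x y x≢y m)
                      (_ , _ , _ , p , l , x↓ , y↓ , lcp-IsLCA₂ x↓ , u≺p , p⪯y , lab , m∈l))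
                    m∉

      N⇒∈ : InN ε m y x → x ∈ᴸ s
      N⇒∈ (inj₁ refl) = ⪯⇒∈ᴸ p↓ y↓ p⪯y
      N⇒∈ (inj₂ (x≢y , m∉)) = ⪯⇒∈ᴸ p↓ x↓ (p⪯x x≢y m∉)

      ∈⇒N : x ∈ᴸ s → InN ε m y x
      ∈⇒N x∈s with x ≟ᶠ y
      ... | yes x≡y = inj₁ x≡y
      ... | no x≢y = inj₂ (x≢y , λ m∈ → no-m-edge (proj₁ (explains x y x≢y m) m∈))
        where
          no-m-edge : HasMEdge T x y m → ⊥
          no-m-edge (px , _ , u , v , l , x↓′ , y↓′ , (_ , _ , u-greatest) ,
                     u≺v , v⪯y , lab , m∈l) =
            ≺⇒⋡ u≺v (u-greatest v (⪯-Vertex v⪯y y↓′) (v⪯x ∷ v⪯y ∷ []))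
            where
              v⪯p : v ⪯ p
              v⪯p = deepest v (subst (v ⪯_) (LeafPos-unique ph y↓′ y↓) v⪯y) (l , lab , m∈l)
              v⪯x : v ⪯ px
              v⪯x = ⪯-trans v⪯p (∈ᴸ⇒⪯ ph p↓ x↓′ x∈s)

  explains⇒𝒩⊆𝒞 : Phylo T → Explains T ε → 𝒩⊆𝒞 T
  explains⇒𝒩⊆𝒞 {T} ph explains y m =
    let p , deepest = deepest-prefix (edge? (m ∈?_) T) (leafPos ph y)
        s , p↓ = ⪯-Vertex (proj₁ deepest) (leafPos-LeafPos ph y)
    in p , s , p↓ , deepest-m-edge-cluster ph explains deepest p↓

  fitch⇒𝒩⊆𝒞-tree : FitchMap ε → Σ (PTree (Fin (suc n))) λ t → Phyloᶜ t × 𝒩⊆𝒞 t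
  fitch⇒𝒩⊆𝒞-tree (T , ph , explains) =
    relabel (const tt) T , Phyloᶜ-relabel (const tt) (Phylo⇒Phyloᶜ ph) ,
    λ y m → IsCluster-relabel (const tt) (explains⇒𝒩⊆𝒞 ph explains y m)

  explains⇒displays-ℛ : Phylo T → Explains T ε → DisplaysAll T (ℛ ε)
  explains⇒displays-ℛ ph explains = 𝒩⊆𝒞⇒displays-ℛ ph (explains⇒𝒩⊆𝒞 ph explains)

  ℛ-compatible : FitchMap ε → Compatible (ℛ ε)
  ℛ-compatible fitch =
    let t , t-phylo , 𝒩t = fitch⇒𝒩⊆𝒞-tree fitch
        ph = Phyloᶜ⇒Phylo t-phylo
    in t , ph , 𝒩⊆𝒞⇒displays-ℛ ph 𝒩t

  module _ (abc∈closure : Closure (ℛ ε) a b c) (abc∉ℛ : ¬ ℛ ε a b c) where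
    no-𝒩⊆𝒞-tree : ∀ (t : PTree (Fin (suc n))) → Acc _<_ (size t) → Phyloᶜ t → 𝒩⊆𝒞 t → ⊥
    no-𝒩⊆𝒞-tree t (acc smaller) t-phylo 𝒩t
      with ph ← Phyloᶜ⇒Phylo t-phylo
      with displays ← abc∈closure t ph (𝒩⊆𝒞⇒displays-ℛ ph 𝒩t)
      with i , w , ds , w↓ , a∈ , b∈ , c∉ ← displays⇒separating-vertex ph displays =
      no-𝒩⊆𝒞-tree (contract (i ∷ w) t) (smaller (size-contract w↓))
                   (Phyloᶜ-contract w↓ t-phylo) 𝒩-contract
      where
        𝒩-contract : 𝒩⊆𝒞 (contract (i ∷ w) t)
        𝒩-contract y m with IsCluster-contract w↓ (𝒩t y m)
        ... | inj₁ cluster = cluster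
        ... | inj₂ N⇔ = contradiction
          (proj₁ displays , y , m , from (N⇔ a) a∈ , from (N⇔ b) b∈ , c∉ ∘ to (N⇔ c)) abc∉ℛ

  closure⊆ℛ : FitchMap ε → Closure (ℛ ε) a b c → ℛ ε a b c
  closure⊆ℛ {a} {b} {c} fitch abc∈closure with ℛ? a b c
  ... | yes abc∈ℛ = abc∈ℛ
  ... | no abc∉ℛ =
    let t , t-phylo , 𝒩t = fitch⇒𝒩⊆𝒞-tree fitch
    in ⊥-elim (no-𝒩⊆𝒞-tree abc∈closure abc∉ℛ t (<-wellFounded (size t)) t-phylo 𝒩t)

proposition2 : (n k : ℕ) (ε : EMap n k) → FitchMap ε →
    (∀ (T : ETree n k) → Phylo T → Explains T ε → DisplaysAll T (ℛ ε)) ×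
    Closed (ℛ ε)
proposition2 n k ε fitch =
  (λ _ → explains⇒displays-ℛ) ,
  ℛ-compatible fitch ,
  λ a b c → closure⊆ℛ fitch , λ abc∈ℛ _ _ displays-ℛ → displays-ℛ a b c abc∈ℛ
  where open Fitch ε
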